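{- Every weakly CIS graph is $\cap$-weakly triangle, i.e., both $G$ and its complement $\overline{G}$ are weakly triangle.
   Context: A family of maximal cliques is edge covering if every two adjacent vertices lie together in some member; a family of maximal stable sets is non-edge covering if every two distinct non-adjacent vertices lie together in some member. Families $\mathcal A,\mathcal B$ are cross-intersecting if $A\cap B\neq\emptyset$ for all $A\in\mathcal A$, $B\in\mathcal B$. A graph is weakly CIS if there is a cross-intersecting pair $\mathcal C,\mathcal S$ where $\mathcal C$ is an edge covering family of maximal cliques and $\mathcal S$ is a non-edge covering family of maximal stable sets. A graph $G$ is weakly triangle if there is a non-edge covering family $\mathcal S$ of maximal stable sets of $G$ such that for every $S\in\mathcal S$ and every pair of adjacent vertices $u,v\in V(G)\setminus S$, $u$ and $v$ have a common neighbor in $S$. -}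

module Defs where

open import Data.Nat using (ℕ)
open import Data.Fin using (Fin)
open import Data.Fin.Subset using (Subset; _∈_; _∉_; _⊆_)
open import Data.List using (List)
open import Data.List.Membership.Propositional using () renaming (_∈_ to _∈ˡ_)
open import Data.Product using (Σ; _×_; _,_; ∃; ∃-syntax)
open import Relation.Nullary using (¬_)
open import Relation.Binary.PropositionalEquality using (_≡_; _≢_)

record Graph (n : ℕ) : Set₁ where
  field
    Adj     : Fin n → Fin n → Set
    symAdj  : ∀ {u v} → Adj u v → Adj v u
    irrAdj  : ∀ {u} → ¬ Adj u u
open Graph public

complement : ∀ {n} → Graph n → Graph n
complement G = record
  { Adj    = λ u v → (u ≢ v) × ¬ Adj G u v
  ; symAdj = λ { (u≢v , ¬a) → (λ e → u≢v (sym' e)) , (λ a → ¬a (symAdj G a)) }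
  ; irrAdj = λ { (u≢u , _) → u≢u Relation.Binary.PropositionalEquality.refl }
  }
  where
  sym' : ∀ {A : Set} {x y : A} → x ≡ y → y ≡ x
  sym' Relation.Binary.PropositionalEquality.refl = Relation.Binary.PropositionalEquality.refl

module _ {n : ℕ} (G : Graph n) where

  IsClique : Subset n → Set
  IsClique S = ∀ u v → u ∈ S → v ∈ S → u ≢ v → Adj G u v

  IsStable : Subset n → Set
  IsStable S = ∀ u v → u ∈ S → v ∈ S → ¬ Adj G u v

  IsMaximalClique : Subset n → Set
  IsMaximalClique S = IsClique S × (∀ T → IsClique T → S ⊆ T → T ⊆ S)

  IsMaximalStable : Subset n → Set
  IsMaximalStable S = IsStable S × (∀ T → IsStable T → S ⊆ T → T ⊆ S)

  EdgeCovering : List (Subset n) → Set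
  EdgeCovering 𝒞 = ∀ u v → Adj G u v → ∃[ C ] (C ∈ˡ 𝒞 × u ∈ C × v ∈ C)

  NonEdgeCovering : List (Subset n) → Set
  NonEdgeCovering 𝒮 = ∀ u v → u ≢ v → ¬ Adj G u v → ∃[ S ] (S ∈ˡ 𝒮 × u ∈ S × v ∈ S)

  WeaklyCIS : Set
  WeaklyCIS = ∃[ 𝒞 ] ∃[ 𝒮 ]
      ((∀ C → C ∈ˡ 𝒞 → IsMaximalClique C)
    × EdgeCovering 𝒞
    × (∀ S → S ∈ˡ 𝒮 → IsMaximalStable S)
    × NonEdgeCovering 𝒮
    × CrossIntersecting 𝒞 𝒮)
    where
    CrossIntersecting : List (Subset n) → List (Subset n) → Set
    CrossIntersecting 𝒜 ℬ = ∀ A B → A ∈ˡ 𝒜 → B ∈ˡ ℬ → ∃[ x ] (x ∈ A × x ∈ B)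

  WeaklyTriangle : Set
  WeaklyTriangle = ∃[ 𝒮 ]
      ((∀ S → S ∈ˡ 𝒮 → IsMaximalStable S)
    × NonEdgeCovering 𝒮
    × (∀ S → S ∈ˡ 𝒮 → ∀ u v → u ∉ S → v ∉ S → Adj G u v →
         ∃[ w ] (w ∈ S × Adj G u w × Adj G v w)))

CapWeaklyTriangle : ∀ {n} → Graph n → Set
CapWeaklyTriangle G = WeaklyTriangle G × WeaklyTriangle (complement G)

module Submission where

-- Proof idea.  Let 𝒞, 𝒮 witness that G is weakly CIS.
--
-- * G is weakly triangle via 𝒮: if u, v ∉ S are adjacent, some clique C ∈ 𝒞
--   contains both, and C meets S in a vertex w; being in the clique C, w is a
--   common neighbour of u and v.
-- * The complement is weakly triangle via 𝒞, by the same argument with the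
--   roles swapped: a stable set of G is a clique of the complement, so 𝒮 is an
--   edge-covering family of cliques of the complement, cross-intersecting 𝒞.
--
-- The only subtle point is constructive: to see that a maximal clique of G is
-- a MAXIMAL stable set of the complement, and that 𝒞 covers the non-edges of
-- the complement, we need adjacency of G to be decidable.  It is, because an
-- edge-covering family of cliques is a finite certificate: u, v are adjacent
-- iff they are distinct and some member of 𝒞 contains both.

open import Data.Nat using (ℕ)
open import Data.Product using (_×_; _,_; ∃-syntax; proj₁)
open import Data.Fin using (Fin)
open import Data.Fin.Properties using (_≟_)
open import Data.Fin.Subset using (Subset; _∈_; _∉_; _⊆_)
open import Data.Fin.Subset.Properties using (_∈?_)
open import Data.List using (List)
open import Data.List.Membership.Propositional using (find; lose) renaming (_∈_ to _∈ˡ_)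
open import Data.List.Relation.Unary.Any using (any?)
open import Data.Empty using (⊥-elim)
open import Relation.Nullary using (Dec; yes; no)
open import Relation.Nullary.Decidable using (map′; _×-dec_; decidable-stable)
open import Relation.Binary.PropositionalEquality using (_≢_; refl)
open import Defs

∉⇒≢ : ∀ {n} {S : Subset n} {u w : Fin n} → u ∉ S → w ∈ S → u ≢ w
∉⇒≢ u∉S w∈S refl = u∉S w∈S

CrossIntersecting : ∀ {n} → List (Subset n) → List (Subset n) → Set
CrossIntersecting 𝒜 ℬ = ∀ A B → A ∈ˡ 𝒜 → B ∈ˡ ℬ → ∃[ x ] (x ∈ A × x ∈ B)

TriangleCondition : ∀ {n} (G : Graph n) → Subset n → Set
TriangleCondition G S = ∀ u v → u ∉ S → v ∉ S → Adj G u v →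
  ∃[ w ] (w ∈ S × Adj G u w × Adj G v w)

covered? : ∀ {n} (𝒞 : List (Subset n)) (u v : Fin n) →
  Dec (∃[ C ] (C ∈ˡ 𝒞 × u ∈ C × v ∈ C))
covered? 𝒞 u v =
  map′ find (λ (C , C∈𝒞 , uv∈C) → lose C∈𝒞 uv∈C)
       (any? (λ C → (u ∈? C) ×-dec (v ∈? C)) 𝒞)

module _ {n : ℕ} (G : Graph n) where

  adjacency-decidable : (𝒞 : List (Subset n)) → (∀ C → C ∈ˡ 𝒞 → IsClique G C) →
    EdgeCovering G 𝒞 → ∀ u v → Dec (Adj G u v)
  adjacency-decidable 𝒞 cliques covers u v with u ≟ v | covered? 𝒞 u v
  ... | yes refl | _                            = no (irrAdj G)
  ... | no u≢v   | yes (C , C∈𝒞 , u∈C , v∈C) = yes (cliques C C∈𝒞 u v u∈C v∈C u≢v)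
  ... | no _     | no uncovered               = no (λ uv → uncovered (covers u v uv))

  stable⇒co-clique : ∀ {S} → IsStable G S → IsClique (complement G) S
  stable⇒co-clique stable u v u∈S v∈S u≢v = u≢v , stable u v u∈S v∈S

  non-edge-cover⇒co-edge-cover : ∀ {𝒮} → NonEdgeCovering G 𝒮 →
    EdgeCovering (complement G) 𝒮
  non-edge-cover⇒co-edge-cover covers u v (u≢v , ¬uv) = covers u v u≢v ¬uv

  module _ (adj? : ∀ u v → Dec (Adj G u v)) where

    co-stable⇒clique : ∀ {T} → IsStable (complement G) T → IsClique G T
    co-stable⇒clique stable u v u∈T v∈T u≢v =
      decidable-stable (adj? u v) (λ ¬uv → stable u v u∈T v∈T (u≢v , ¬uv))

    max-clique⇒co-max-stable : ∀ {C} → IsMaximalClique G C →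
      IsMaximalStable (complement G) C
    max-clique⇒co-max-stable (clique , maximal) =
        (λ u v u∈C v∈C (u≢v , ¬uv) → ¬uv (clique u v u∈C v∈C u≢v))
      , (λ T stable C⊆T → maximal T (co-stable⇒clique stable) C⊆T)

    edge-cover⇒co-non-edge-cover : ∀ {𝒞} → EdgeCovering G 𝒞 →
      NonEdgeCovering (complement G) 𝒞
    edge-cover⇒co-non-edge-cover covers u v u≢v ¬co-uv with adj? u v
    ... | yes uv = covers u v uv
    ... | no ¬uv = ⊥-elim (¬co-uv (u≢v , ¬uv))

  clique-cover⇒triangle : ∀ {𝒞 𝒮} → (∀ C → C ∈ˡ 𝒞 → IsClique G C) →
    EdgeCovering G 𝒞 → CrossIntersecting 𝒞 𝒮 →
    ∀ S → S ∈ˡ 𝒮 → TriangleCondition G S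
  clique-cover⇒triangle cliques covers cross S S∈𝒮 u v u∉S v∉S uv =
    let C , C∈𝒞 , u∈C , v∈C = covers u v uv
        w , w∈C , w∈S       = cross C S C∈𝒞 S∈𝒮
        clique              = cliques C C∈𝒞
    in w , w∈S , clique u w u∈C w∈C (∉⇒≢ u∉S w∈S)
               , clique v w v∈C w∈C (∉⇒≢ v∉S w∈S)

proposition20 : ∀ (n : ℕ) (G : Graph n) → WeaklyCIS G → WeaklyTriangle G × WeaklyTriangle (complement G)
proposition20 n G (𝒞 , 𝒮 , max-cliques , covers , max-stables , non-covers , cross) =
    (𝒮 , max-stables , non-covers ,
       clique-cover⇒triangle G cliques covers cross)
  , (𝒞 , (λ C C∈𝒞 → max-clique⇒co-max-stable G adj? (max-cliques C C∈𝒞))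
       , edge-cover⇒co-non-edge-cover G adj? covers
       , clique-cover⇒triangle (complement G) co-cliques
           (non-edge-cover⇒co-edge-cover G non-covers) cross-flipped)
  where
  cliques : ∀ C → C ∈ˡ 𝒞 → IsClique G C
  cliques C C∈𝒞 = proj₁ (max-cliques C C∈𝒞)

  co-cliques : ∀ S → S ∈ˡ 𝒮 → IsClique (complement G) S
  co-cliques S S∈𝒮 = stable⇒co-clique G (proj₁ (max-stables S S∈𝒮))

  adj? : ∀ u v → Dec (Adj G u v)
  adj? = adjacency-decidable G 𝒞 cliques covers

  cross-flipped : CrossIntersecting 𝒮 𝒞
  cross-flipped S C S∈𝒮 C∈𝒞 = let x , x∈C , x∈S = cross C S C∈𝒞 S∈𝒮 in x , x∈S , x∈C
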